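{- The system $\mathsf{DG}+(\exists^{2})^{\mathrm{st}}$ is inconsistent, where $(\exists^2)$ is the statement $(\exists\varphi^{2})(\forall f^{1})\big[(\exists n^{0})(f(n)=0)\leftrightarrow\varphi(f)=0\big]$ and $(\exists^2)^{\mathrm{st}}$ is $(\exists^{\mathrm{st}}\varphi^{2})(\forall^{\mathrm{st}} f^{1})\big[(\exists^{\mathrm{st}} n^{0})(f(n)=0)\leftrightarrow\varphi(f)=0\big]$.
   Context: Finite types: $0$ is a type and if $\rho,\sigma$ are types so is $\rho\to\sigma$; type $1=0\to0$, $2=1\to0$. $\mathsf{E\text{ - }HA}^{\omega}$ is Heyting arithmetic in all finite types (intuitionistic logic, Gödel's $T$ constants) with extensionality. Equality $=_0$ is primitive; for $\tau=\tau_1\to\dots\to\tau_k\to0$, $x=_\tau y$ abbreviates $(\forall z_1\dots z_k)(xz_1\dots z_k=_0yz_1\dots z_k)$, and $\le_\tau$ likewise. Extensionality $(\mathsf E_{\rho\to\tau})$: $(\forall\varphi)(\forall x,y)(x=_\rho y\to\varphi(x)=_\tau\varphi(y))$, for all types. Strong majorizability (Howard–Bezem): $x\le^*_0 y$ iff $x\le_0 y$; $x\le^*_{\rho\to\sigma}y$ iff for all $u,v$ with $u\le^*_\rho v$: $xu\le^*_\sigma yv$ and $yu\le^*_\sigma yv$. Monotone: $x\le^*x$; $\tilde\forall,\tilde\exists$ range over monotone objects. The language of $\mathsf{DG}$ adds predicates $\mathrm{st}^\sigma$ ("is standard"); $\forall^{\mathrm{st}},\exists^{\mathrm{st}}$ are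 the relativised quantifiers, $\tilde\forall^{\mathrm{st}},\tilde\exists^{\mathrm{st}}$ combine both restrictions. Internal = not containing $\mathrm{st}$. For internal $A$, $A^{\mathrm{st}}$ relativises all quantifiers except bounded number quantifiers to $\mathrm{st}$. $\mathsf{DG}$ is $\mathsf{E\text{ - }HA}^\omega$ in the extended language plus: (a) $x=_\sigma y\to(\mathrm{st}(x)\to\mathrm{st}(y))$; (b) $\mathrm{st}(y)\to(x\le^*_\sigma y\to\mathrm{st}(x))$; (c) $\mathrm{st}(t)$ for closed terms $t$; (d) $\mathrm{st}(z)\to(\mathrm{st}(x)\to\mathrm{st}(zx))$; external induction $\Phi(0)\wedge(\forall^{\mathrm{st}}n)(\Phi(n)\to\Phi(n+1))\to(\forall^{\mathrm{st}}n)\Phi(n)$ for any $\Phi$; and for arbitrary $\Phi,\Psi$ and internal $\phi,\psi$: $\mathsf{mAC}^\omega$: $(\tilde\forall^{\mathrm{st}}x)(\tilde\exists^{\mathrm{st}}y)\Phi(x,y)\to(\tilde\exists^{\mathrm{st}}f)(\tilde\forall^{\mathrm{st}}x)(\exists y\le^*f(x))\Phi(x,y)$; $\mathsf R^\omega$: $(\forall x)(\exists^{\mathrm{st}}y)\Phi(x,y)\to(\tilde\exists^{\mathrm{st}}z)(\forall x)(\exists y\le^*z)\Phi(x,y)$; $\mathsf I^\omega$: $(\tilde\forall^{\mathrm{st}}z)(\exists x)(\forall y\le^*z)\phi(x,y)\to(\exists x)(\forall^{\mathrm{st}}y)\phi(x,y)$; $\mathsf{IP}^\omega_{\tilde\forall^{\mathrm{st}}}$: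 $[(\tilde\forall^{\mathrm{st}}x)\phi(x)\to(\tilde\exists^{\mathrm{st}}y)\Psi(y)]\to(\tilde\exists^{\mathrm{st}}z)[(\tilde\forall^{\mathrm{st}}x)\phi(x)\to(\tilde\exists y\le^*z)\Psi(y)]$; $\mathsf M^\omega$: $[(\tilde\forall^{\mathrm{st}}x)\phi(x)\to\psi]\to(\tilde\exists^{\mathrm{st}}y)[(\forall x\le^*y)\phi(x)\to\psi]$; $\mathsf{MAJ}^\omega$: $(\forall^{\mathrm{st}}x)(\exists^{\mathrm{st}}y)(x\le^*y)$. -}

module Defs where

-- A deep embedding of the formal theory DG (+ (∃²)^st):
-- finite types, Gödel's T terms (combinatory version), formulas of the
-- extended language (with st), intuitionistic natural deduction, and the
-- axioms of E-HA^ω (in the extended language; induction only for internal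
-- formulas) together with the DG axioms.

open import Data.List using (List; []; _∷_; map)
open import Data.List.Membership.Propositional using (_∈_)

infixr 7 _⇒_
data Ty : Set where
  ι   : Ty               -- type 0
  _⇒_ : Ty → Ty → Ty

T1 : Ty
T1 = ι ⇒ ι

T2 : Ty
T2 = T1 ⇒ ι

Ctx : Set
Ctx = List Ty

variable
  Γ Δ : Ctx
  ρ σ τ : Ty

data _∋_ : Ctx → Ty → Set where
  here  : (σ ∷ Γ) ∋ σ
  there : Γ ∋ σ → (τ ∷ Γ) ∋ σ

infixl 9 _·_
data Tm (Γ : Ctx) : Ty → Set where
  var : Γ ∋ σ → Tm Γ σ
  𝟎   : Tm Γ ι
  𝐒   : Tm Γ (ι ⇒ ι)
  𝚷   : Tm Γ (ρ ⇒ σ ⇒ ρ)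
  𝚺   : Tm Γ ((ρ ⇒ σ ⇒ τ) ⇒ (ρ ⇒ σ) ⇒ ρ ⇒ τ)
  𝐑   : Tm Γ (σ ⇒ (σ ⇒ ι ⇒ σ) ⇒ ι ⇒ σ)
  _·_ : Tm Γ (σ ⇒ τ) → Tm Γ σ → Tm Γ τ

v0 : Tm (σ ∷ Γ) σ
v0 = var here

v1 : Tm (τ ∷ σ ∷ Γ) σ
v1 = var (there here)

v2 : Tm (ρ ∷ τ ∷ σ ∷ Γ) σ
v2 = var (there (there here))

infixr 4 _⊃_
infixr 5 _∨ᶠ_
infixr 6 _∧ᶠ_
infix 7 _≐_

data Fm (Γ : Ctx) : Set where
  _≐_  : Tm Γ ι → Tm Γ ι → Fm Γ
  st   : Tm Γ σ → Fm Γ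
  ⊥ᶠ   : Fm Γ
  _∧ᶠ_ : Fm Γ → Fm Γ → Fm Γ
  _∨ᶠ_ : Fm Γ → Fm Γ → Fm Γ
  _⊃_  : Fm Γ → Fm Γ → Fm Γ
  ∀ᶠ   : (σ : Ty) → Fm (σ ∷ Γ) → Fm Γ
  ∃ᶠ   : (σ : Ty) → Fm (σ ∷ Γ) → Fm Γ

data Internal {Γ : Ctx} : Fm Γ → Set where
  i≐ : {s t : Tm Γ ι} → Internal (s ≐ t)
  i⊥ : Internal ⊥ᶠ
  i∧ : {A B : Fm Γ} → Internal A → Internal B → Internal (A ∧ᶠ B)
  i∨ : {A B : Fm Γ} → Internal A → Internal B → Internal (A ∨ᶠ B)
  i⊃ : {A B : Fm Γ} → Internal A → Internal B → Internal (A ⊃ B)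
  i∀ : {A : Fm (σ ∷ Γ)} → Internal A → Internal (∀ᶠ σ A)
  i∃ : {A : Fm (σ ∷ Γ)} → Internal A → Internal (∃ᶠ σ A)

Ren : Ctx → Ctx → Set
Ren Γ Δ = ∀ {σ} → Γ ∋ σ → Δ ∋ σ

ext : Ren Γ Δ → Ren (τ ∷ Γ) (τ ∷ Δ)
ext r here      = here
ext r (there x) = there (r x)

renT : Ren Γ Δ → Tm Γ σ → Tm Δ σ
renT r (var x) = var (r x)
renT r 𝟎       = 𝟎
renT r 𝐒       = 𝐒
renT r 𝚷       = 𝚷
renT r 𝚺       = 𝚺
renT r 𝐑       = 𝐑
renT r (s · t) = renT r s · renT r t

renF : Ren Γ Δ → Fm Γ → Fm Δ
renF r (s ≐ t)  = renT r s ≐ renT r t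
renF r (st t)   = st (renT r t)
renF r ⊥ᶠ       = ⊥ᶠ
renF r (A ∧ᶠ B) = renF r A ∧ᶠ renF r B
renF r (A ∨ᶠ B) = renF r A ∨ᶠ renF r B
renF r (A ⊃ B)  = renF r A ⊃ renF r B
renF r (∀ᶠ σ A) = ∀ᶠ σ (renF (ext r) A)
renF r (∃ᶠ σ A) = ∃ᶠ σ (renF (ext r) A)

wkT : Tm Γ σ → Tm (τ ∷ Γ) σ
wkT = renT there

wk : Fm Γ → Fm (τ ∷ Γ)
wk = renF there

wk₁ : Fm (σ ∷ Γ) → Fm (σ ∷ ρ ∷ Γ)
wk₁ = renF (ext there)

wk₂ : Fm (τ ∷ σ ∷ Γ) → Fm (τ ∷ σ ∷ ρ ∷ Γ)
wk₂ = renF (ext (ext there))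

closed : Tm [] σ → Tm Γ σ
closed = renT (λ ())

Sub : Ctx → Ctx → Set
Sub Γ Δ = ∀ {σ} → Γ ∋ σ → Tm Δ σ

exts : Sub Γ Δ → Sub (τ ∷ Γ) (τ ∷ Δ)
exts s here      = var here
exts s (there x) = wkT (s x)

subT : Sub Γ Δ → Tm Γ σ → Tm Δ σ
subT s (var x) = s x
subT s 𝟎       = 𝟎
subT s 𝐒       = 𝐒
subT s 𝚷       = 𝚷
subT s 𝚺       = 𝚺
subT s 𝐑       = 𝐑
subT s (a · b) = subT s a · subT s b

subF : Sub Γ Δ → Fm Γ → Fm Δ
subF s (a ≐ b)  = subT s a ≐ subT s b
subF s (st t)   = st (subT s t)
subF s ⊥ᶠ       = ⊥ᶠ
subF s (A ∧ᶠ B) = subF s A ∧ᶠ subF s B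
subF s (A ∨ᶠ B) = subF s A ∨ᶠ subF s B
subF s (A ⊃ B)  = subF s A ⊃ subF s B
subF s (∀ᶠ σ A) = ∀ᶠ σ (subF (exts s) A)
subF s (∃ᶠ σ A) = ∃ᶠ σ (subF (exts s) A)

sub₀ : Tm Γ σ → Sub (σ ∷ Γ) Γ
sub₀ t here      = t
sub₀ t (there x) = var x

_[_] : Fm (σ ∷ Γ) → Tm Γ σ → Fm Γ
A [ t ] = subF (sub₀ t) A

subSucc : Sub (ι ∷ Γ) (ι ∷ Γ)
subSucc here      = 𝐒 · var here
subSucc (there x) = var (there x)

eqAt : (σ : Ty) → Tm Γ σ → Tm Γ σ → Fm Γ
eqAt ι x y       = x ≐ y
eqAt (ρ ⇒ τ) x y = ∀ᶠ ρ (eqAt τ (wkT x · v0) (wkT y · v0))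

infix 7 eqAt
syntax eqAt σ x y = x ≐[ σ ] y

-- composition combinator B f g x = f (g x), B := Σ(ΠΣ)Π
𝐁 : Tm Γ ((σ ⇒ τ) ⇒ (ρ ⇒ σ) ⇒ ρ ⇒ τ)
𝐁 {σ = σ} {τ = τ} {ρ = ρ} =
  𝚺 {ρ = σ ⇒ τ} {σ = ρ ⇒ σ ⇒ τ} {τ = (ρ ⇒ σ) ⇒ ρ ⇒ τ} · (𝚷 · 𝚺) · 𝚷

-- addition: plus x z := R x (λu n. S u) z,  λu n. S u := B (B S) Π
plus : Tm Γ ι → Tm Γ ι → Tm Γ ι
plus x z = 𝐑 · x · (𝐁 {σ = ι ⇒ ι} {τ = ι ⇒ ι} {ρ = ι} · (𝐁 · 𝐒) · 𝚷) · z

_≤₀_ : Tm Γ ι → Tm Γ ι → Fm Γ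
x ≤₀ y = ∃ᶠ ι (plus (wkT x) v0 ≐ wkT y)

maj : (σ : Ty) → Tm Γ σ → Tm Γ σ → Fm Γ
maj ι x y       = x ≤₀ y
maj (ρ ⇒ σ) x y =
  ∀ᶠ ρ (∀ᶠ ρ (maj ρ v1 v0 ⊃
    (maj σ (wkT (wkT x) · v1) (wkT (wkT y) · v0)
     ∧ᶠ maj σ (wkT (wkT y) · v1) (wkT (wkT y) · v0))))

mon : (σ : Ty) → Tm Γ σ → Fm Γ
mon σ x = maj σ x x

∀st ∃st ∀̃st ∃̃st : (σ : Ty) → Fm (σ ∷ Γ) → Fm Γ
∀st σ A = ∀ᶠ σ (st v0 ⊃ A)
∃st σ A = ∃ᶠ σ (st v0 ∧ᶠ A)
∀̃st σ A = ∀ᶠ σ (st v0 ⊃ mon σ v0 ⊃ A)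
∃̃st σ A = ∃ᶠ σ (st v0 ∧ᶠ mon σ v0 ∧ᶠ A)

∀≤* ∃≤* ∃̃≤* : (σ : Ty) → Tm Γ σ → Fm (σ ∷ Γ) → Fm Γ
∀≤* σ t A = ∀ᶠ σ (maj σ v0 (wkT t) ⊃ A)
∃≤* σ t A = ∃ᶠ σ (maj σ v0 (wkT t) ∧ᶠ A)
∃̃≤* σ t A = ∃ᶠ σ (mon σ v0 ∧ᶠ maj σ v0 (wkT t) ∧ᶠ A)

data Pf (Ax : (Γ : Ctx) → Fm Γ → Set) : (Γ : Ctx) → List (Fm Γ) → Fm Γ → Set where
  hyp  : {H : List (Fm Γ)} {A : Fm Γ} → A ∈ H → Pf Ax Γ H A
  ax   : {H : List (Fm Γ)} {A : Fm Γ} → Ax Γ A → Pf Ax Γ H A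
  ⊥E   : {H : List (Fm Γ)} {A : Fm Γ} → Pf Ax Γ H ⊥ᶠ → Pf Ax Γ H A
  ∧I   : {H : List (Fm Γ)} {A B : Fm Γ} → Pf Ax Γ H A → Pf Ax Γ H B → Pf Ax Γ H (A ∧ᶠ B)
  ∧E₁  : {H : List (Fm Γ)} {A B : Fm Γ} → Pf Ax Γ H (A ∧ᶠ B) → Pf Ax Γ H A
  ∧E₂  : {H : List (Fm Γ)} {A B : Fm Γ} → Pf Ax Γ H (A ∧ᶠ B) → Pf Ax Γ H B
  ∨I₁  : {H : List (Fm Γ)} {A B : Fm Γ} → Pf Ax Γ H A → Pf Ax Γ H (A ∨ᶠ B)
  ∨I₂  : {H : List (Fm Γ)} {A B : Fm Γ} → Pf Ax Γ H B → Pf Ax Γ H (A ∨ᶠ B)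
  ∨E   : {H : List (Fm Γ)} {A B C : Fm Γ} → Pf Ax Γ H (A ∨ᶠ B) →
         Pf Ax Γ (A ∷ H) C → Pf Ax Γ (B ∷ H) C → Pf Ax Γ H C
  ⊃I   : {H : List (Fm Γ)} {A B : Fm Γ} → Pf Ax Γ (A ∷ H) B → Pf Ax Γ H (A ⊃ B)
  ⊃E   : {H : List (Fm Γ)} {A B : Fm Γ} → Pf Ax Γ H (A ⊃ B) → Pf Ax Γ H A → Pf Ax Γ H B
  ∀I   : {H : List (Fm Γ)} {A : Fm (σ ∷ Γ)} →
         Pf Ax (σ ∷ Γ) (map wk H) A → Pf Ax Γ H (∀ᶠ σ A)
  ∀E   : {H : List (Fm Γ)} {A : Fm (σ ∷ Γ)} →
         Pf Ax Γ H (∀ᶠ σ A) → (t : Tm Γ σ) → Pf Ax Γ H (A [ t ])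
  ∃I   : {H : List (Fm Γ)} {A : Fm (σ ∷ Γ)} →
         (t : Tm Γ σ) → Pf Ax Γ H (A [ t ]) → Pf Ax Γ H (∃ᶠ σ A)
  ∃E   : {H : List (Fm Γ)} {A : Fm (σ ∷ Γ)} {C : Fm Γ} →
         Pf Ax Γ H (∃ᶠ σ A) → Pf Ax (σ ∷ Γ) (A ∷ map wk H) (wk C) → Pf Ax Γ H C

data DG : (Γ : Ctx) → Fm Γ → Set where
  eq-refl   : (x : Tm Γ ι) → DG Γ (x ≐ x)
  eq-subst  : (A : Fm (ι ∷ Γ)) (x y : Tm Γ ι) → DG Γ (x ≐ y ⊃ A [ x ] ⊃ A [ y ])
  S≠0       : (x : Tm Γ ι) → DG Γ (𝐒 · x ≐ 𝟎 ⊃ ⊥ᶠ)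
  S-inj     : (x y : Tm Γ ι) → DG Γ (𝐒 · x ≐ 𝐒 · y ⊃ x ≐ y)
  Π-ax      : (x : Tm Γ ρ) (y : Tm Γ σ) → DG Γ (𝚷 · x · y ≐[ ρ ] x)
  Σ-ax      : (x : Tm Γ (ρ ⇒ σ ⇒ τ)) (y : Tm Γ (ρ ⇒ σ)) (z : Tm Γ ρ) →
              DG Γ (𝚺 · x · y · z ≐[ τ ] x · z · (y · z))
  R-ax₀     : (x : Tm Γ σ) (y : Tm Γ (σ ⇒ ι ⇒ σ)) → DG Γ (𝐑 · x · y · 𝟎 ≐[ σ ] x)
  R-axS     : (x : Tm Γ σ) (y : Tm Γ (σ ⇒ ι ⇒ σ)) (n : Tm Γ ι) →
              DG Γ (𝐑 · x · y · (𝐒 · n) ≐[ σ ] y · (𝐑 · x · y · n) · n)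
  ind       : (A : Fm (ι ∷ Γ)) → Internal A →
              DG Γ (A [ 𝟎 ] ∧ᶠ ∀ᶠ ι (A ⊃ subF subSucc A) ⊃ ∀ᶠ ι A)
  ext-ax    : (φ : Tm Γ (ρ ⇒ τ)) (x y : Tm Γ ρ) →
              DG Γ (x ≐[ ρ ] y ⊃ φ · x ≐[ τ ] φ · y)
  st-eq     : (x y : Tm Γ σ) → DG Γ (x ≐[ σ ] y ⊃ st x ⊃ st y)
  st-maj    : (x y : Tm Γ σ) → DG Γ (st y ⊃ maj σ x y ⊃ st x)
  st-closed : (t : Tm [] σ) → DG Γ (st (closed t))
  st-app    : (z : Tm Γ (σ ⇒ τ)) (x : Tm Γ σ) → DG Γ (st z ⊃ st x ⊃ st (z · x))
  ext-ind   : (Φ : Fm (ι ∷ Γ)) →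
              DG Γ (Φ [ 𝟎 ] ∧ᶠ ∀st ι (Φ ⊃ subF subSucc Φ) ⊃ ∀st ι Φ)
  -- mAC^ω   (Φ(x,y): x = v1 : σ, y = v0 : τ)
  mAC       : (Φ : Fm (τ ∷ σ ∷ Γ)) →
              DG Γ (∀̃st σ (∃̃st τ Φ) ⊃
                    ∃̃st (σ ⇒ τ) (∀̃st σ (∃≤* τ (v1 · v0) (wk₂ Φ))))
  R-ax      : (Φ : Fm (τ ∷ σ ∷ Γ)) →
              DG Γ (∀ᶠ σ (∃st τ Φ) ⊃ ∃̃st τ (∀ᶠ σ (∃≤* τ v1 (wk₂ Φ))))
  -- I^ω     (φ(x,y): x = v1 : σ, y = v0 : τ; φ internal)
  I-ax      : (φ : Fm (τ ∷ σ ∷ Γ)) → Internal φ →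
              DG Γ (∀̃st τ (∃ᶠ σ (∀≤* τ v1 (wk₂ φ))) ⊃ ∃ᶠ σ (∀st τ φ))
  IP-ax     : (φ : Fm (σ ∷ Γ)) → Internal φ → (Ψ : Fm (τ ∷ Γ)) →
              DG Γ ((∀̃st σ φ ⊃ ∃̃st τ Ψ) ⊃
                    ∃̃st τ (∀̃st σ (wk₁ φ) ⊃ ∃̃≤* τ v0 (wk₁ Ψ)))
  M-ax      : (φ : Fm (σ ∷ Γ)) → Internal φ → (ψ : Fm Γ) → Internal ψ →
              DG Γ ((∀̃st σ φ ⊃ ψ) ⊃ ∃̃st σ (∀≤* σ v0 (wk₁ φ) ⊃ wk ψ))
  MAJ       : (σ : Ty) → DG Γ (∀st σ (∃st σ (maj σ v1 v0)))

E2st : Fm Γ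
E2st = ∃st T2 (∀st T1
  ((∃st ι (v1 · v0 ≐ 𝟎) ⊃ v1 · v0 ≐ 𝟎) ∧ᶠ (v1 · v0 ≐ 𝟎 ⊃ ∃st ι (v1 · v0 ≐ 𝟎))))

data DG+E2st : (Γ : Ctx) → Fm Γ → Set where
  dg  : {A : Fm Γ} → DG Γ A → DG+E2st Γ A
  e2  : DG+E2st Γ E2st

Inconsistent : ((Γ : Ctx) → Fm Γ → Set) → Set
Inconsistent Ax = Pf Ax [] [] ⊥ᶠ

-- Every function χ<N (1 below N, 0 from N on) is majorised by the constant
-- function 1, hence standard. If φ is a standard witness of (∃²)^st, then
-- φ(χ<N) = 0 says that χ<N has a standard zero; this is internal in N and
-- propagates from N to N+1 (a standard zero n of χ<N gives the standard zero
-- n+1 of χ<(N+1)), so by internal induction it holds for all N. A standard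
-- zero of χ<N lies above N, so every number is standard. Idealisation (I^ω)
-- applied to y ≤ x yields a number x above all standard y, and then x+1 ≤ x.
module Submission where

open import Defs
open import Data.List using (List; _∷_; map)
import Data.List.Relation.Unary.Any as Any
open import Relation.Binary.Bundles using (Setoid)
import Relation.Binary.Reasoning.Setoid as SetoidReasoning
open import Relation.Binary.PropositionalEquality
  using (_≡_; refl; sym; trans; cong; cong₂; subst)

variable
  Θ : Ctx
  α : Ty

v3 : Tm (α ∷ ρ ∷ τ ∷ σ ∷ Γ) σ
v3 = var (there (there (there here)))

subT-renT : (s : Sub Δ Θ) (r : Ren Γ Δ) (t : Tm Γ σ) →
            subT s (renT r t) ≡ subT (λ x → s (r x)) t
subT-renT s r (var x) = refl
subT-renT s r 𝟎       = refl
subT-renT s r 𝐒       = refl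
subT-renT s r 𝚷       = refl
subT-renT s r 𝚺       = refl
subT-renT s r 𝐑       = refl
subT-renT s r (a · b) = cong₂ _·_ (subT-renT s r a) (subT-renT s r b)

renT-subT : (r : Ren Δ Θ) (s : Sub Γ Δ) (t : Tm Γ σ) →
            renT r (subT s t) ≡ subT (λ x → renT r (s x)) t
renT-subT r s (var x) = refl
renT-subT r s 𝟎       = refl
renT-subT r s 𝐒       = refl
renT-subT r s 𝚷       = refl
renT-subT r s 𝚺       = refl
renT-subT r s 𝐑       = refl
renT-subT r s (a · b) = cong₂ _·_ (renT-subT r s a) (renT-subT r s b)

subT-var : (t : Tm Γ σ) → subT var t ≡ t
subT-var (var x) = refl
subT-var 𝟎       = refl
subT-var 𝐒       = refl
subT-var 𝚷       = refl
subT-var 𝚺       = refl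
subT-var 𝐑       = refl
subT-var (a · b) = cong₂ _·_ (subT-var a) (subT-var b)

subT-sub₀-wkT : (u : Tm Γ ρ) (t : Tm Γ σ) → subT (sub₀ u) (wkT t) ≡ t
subT-sub₀-wkT u t = trans (subT-renT (sub₀ u) there t) (subT-var t)

subT-exts-wkT : (s : Sub Γ Δ) (t : Tm Γ σ) →
                subT (exts {τ = τ} s) (wkT t) ≡ wkT (subT s t)
subT-exts-wkT s t = trans (subT-renT (exts s) there t) (sym (renT-subT there s t))

subF-eqAt : (s : Sub Γ Δ) (σ : Ty) (a b : Tm Γ σ) →
            subF s (a ≐[ σ ] b) ≡ (subT s a ≐[ σ ] subT s b)
subF-eqAt s ι       a b = refl
subF-eqAt s (ρ ⇒ τ) a b = cong (∀ᶠ ρ)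
  (trans (subF-eqAt (exts s) τ (wkT a · v0) (wkT b · v0))
         (cong₂ (λ x y → x · v0 ≐[ τ ] y · v0) (subT-exts-wkT s a) (subT-exts-wkT s b)))

-- An equation x =_σ y is used by applying both sides to a full argument list.
infixr 5 _∷ᵃ_
data Args (Γ : Ctx) : Ty → Set where
  []ᵃ  : Args Γ ι
  _∷ᵃ_ : Tm Γ ρ → Args Γ σ → Args Γ (ρ ⇒ σ)

infixl 8 _⋆_
_⋆_ : Tm Γ σ → Args Γ σ → Tm Γ ι
t ⋆ []ᵃ       = t
t ⋆ (u ∷ᵃ us) = (t · u) ⋆ us

one : Tm Γ ι
one = 𝐒 · 𝟎

-- χ< N is the characteristic function of {m | m < N}, by primitive recursion
-- on N: χ< (S N) = R 1 (λ _ k. χ< N k), written with 𝐁 and 𝚷 instead of λ.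
χ<-step : Tm Γ ((ι ⇒ ι) ⇒ ι ⇒ ι ⇒ ι)
χ<-step = 𝐁 · 𝚷 · (𝐁 · (𝐑 · one) · 𝚷)

χ< : Tm Γ ι → Tm Γ (ι ⇒ ι)
χ< N = 𝐑 · (𝚷 · 𝟎) · χ<-step · N

-- E2st unfolds to ∃st T2 ∃²-spec.
∃²-spec : Fm (T2 ∷ Γ)
∃²-spec = ∀st T1 ((∃st ι (v1 · v0 ≐ 𝟎) ⊃ v1 · v0 ≐ 𝟎) ∧ᶠ (v1 · v0 ≐ 𝟎 ⊃ ∃st ι (v1 · v0 ≐ 𝟎)))

module Derivations {Ax : (Γ : Ctx) → Fm Γ → Set} (dg : ∀ {Γ A} → DG Γ A → Ax Γ A) where

  infix 2 _⊢_
  _⊢_ : List (Fm Γ) → Fm Γ → Set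
  H ⊢ A = Pf Ax _ H A

  variable
    H : List (Fm Γ)
    A B C D : Fm Γ

  axiom : DG Γ A → H ⊢ A
  axiom d = ax (dg d)

  hyp₀ : A ∷ H ⊢ A
  hyp₀ = hyp (Any.here refl)

  hyp₁ : B ∷ A ∷ H ⊢ A
  hyp₁ = hyp (Any.there (Any.here refl))

  hyp₂ : C ∷ B ∷ A ∷ H ⊢ A
  hyp₂ = hyp (Any.there (Any.there (Any.here refl)))

  hyp₃ : D ∷ C ∷ B ∷ A ∷ H ⊢ A
  hyp₃ = hyp (Any.there (Any.there (Any.there (Any.here refl))))

  cut : H ⊢ A → A ∷ H ⊢ B → H ⊢ B
  cut p q = ⊃E (⊃I q) p

  induction : (A : Fm (ι ∷ Γ)) → Internal A → H ⊢ A [ 𝟎 ] →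
              A ∷ map wk H ⊢ subF subSucc A → H ⊢ ∀ᶠ ι A
  induction A i base step = ⊃E (axiom (ind A i)) (∧I base (∀I (⊃I step)))

  ≐-refl : {x : Tm Γ ι} → H ⊢ x ≐ x
  ≐-refl {x = x} = axiom (eq-refl x)

  ≐-subst : (A : Fm (ι ∷ Γ)) {x y : Tm Γ ι} → H ⊢ x ≐ y → H ⊢ A [ x ] → H ⊢ A [ y ]
  ≐-subst A {x} {y} x≐y p = ⊃E (⊃E (axiom (eq-subst A x y)) x≐y) p

  ≐-cong : (C : Tm (ι ∷ Γ) ι) {x y : Tm Γ ι} → H ⊢ x ≐ y →
           H ⊢ subT (sub₀ x) C ≐ subT (sub₀ y) C
  ≐-cong {H = H} C {x} {y} x≐y =
    subst (λ z → H ⊢ z ≐ Cy) (subT-sub₀-wkT y Cx)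
      (≐-subst (wkT Cx ≐ C) x≐y
        (subst (λ z → H ⊢ z ≐ Cx) (sym (subT-sub₀-wkT x Cx)) ≐-refl))
    where
    Cx = subT (sub₀ x) C
    Cy = subT (sub₀ y) C

  ≐-sym : {x y : Tm Γ ι} → H ⊢ x ≐ y → H ⊢ y ≐ x
  ≐-sym {H = H} {x} {y} x≐y =
    subst (λ z → H ⊢ y ≐ z) (subT-sub₀-wkT y x)
      (≐-subst (v0 ≐ wkT x) x≐y (subst (λ z → H ⊢ x ≐ z) (sym (subT-sub₀-wkT x x)) ≐-refl))

  ≐-trans : {x y z : Tm Γ ι} → H ⊢ x ≐ y → H ⊢ y ≐ z → H ⊢ x ≐ z
  ≐-trans {H = H} {x} {y} {z} x≐y y≐z =
    subst (λ w → H ⊢ w ≐ z) (subT-sub₀-wkT z x)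
      (≐-subst (wkT x ≐ v0) y≐z (subst (λ w → H ⊢ w ≐ y) (sym (subT-sub₀-wkT y x)) x≐y))

  ≐-cong-app : (f : Tm Γ (ι ⇒ ι)) {x y : Tm Γ ι} → H ⊢ x ≐ y → H ⊢ f · x ≐ f · y
  ≐-cong-app {H = H} f {x} {y} x≐y =
    subst (λ w → H ⊢ f · x ≐ w · y) (subT-sub₀-wkT y f)
      (subst (λ w → H ⊢ w · x ≐ subT (sub₀ y) (wkT f) · y) (subT-sub₀-wkT x f)
        (≐-cong (wkT f · v0) x≐y))

  ≐-setoid : List (Fm Γ) → Setoid _ _
  ≐-setoid {Γ} H = record
    { Carrier       = Tm Γ ι
    ; _≈_           = λ x y → H ⊢ x ≐ y
    ; isEquivalence = record { refl = ≐-refl ; sym = ≐-sym ; trans = ≐-trans }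
    }

  module ≐-Reasoning {Γ} (H : List (Fm Γ)) = SetoidReasoning (≐-setoid H)

  eqAt-· : {a b : Tm Γ (ρ ⇒ σ)} → H ⊢ a ≐[ ρ ⇒ σ ] b → (u : Tm Γ ρ) → H ⊢ a · u ≐[ σ ] b · u
  eqAt-· {σ = σ} {H = H} {a} {b} p u =
    subst (H ⊢_)
      (trans (subF-eqAt (sub₀ u) σ (wkT a · v0) (wkT b · v0))
             (cong₂ (λ x y → x · u ≐[ σ ] y · u) (subT-sub₀-wkT u a) (subT-sub₀-wkT u b)))
      (∀E p u)

  eqAt-⋆ : {a b : Tm Γ σ} → H ⊢ a ≐[ σ ] b → (us : Args Γ σ) → H ⊢ a ⋆ us ≐ b ⋆ us
  eqAt-⋆ p []ᵃ       = p
  eqAt-⋆ p (u ∷ᵃ us) = eqAt-⋆ (eqAt-· p u) us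

  𝚷-⋆ : (x : Tm Γ ρ) (y : Tm Γ σ) (us : Args Γ ρ) → H ⊢ 𝚷 · x · y ⋆ us ≐ x ⋆ us
  𝚷-⋆ x y = eqAt-⋆ (axiom (Π-ax x y))

  𝚺-⋆ : (x : Tm Γ (ρ ⇒ σ ⇒ τ)) (y : Tm Γ (ρ ⇒ σ)) (z : Tm Γ ρ) (us : Args Γ τ) →
        H ⊢ 𝚺 · x · y · z ⋆ us ≐ x · z · (y · z) ⋆ us
  𝚺-⋆ x y z = eqAt-⋆ (axiom (Σ-ax x y z))

  𝐑-zero-⋆ : (x : Tm Γ σ) (y : Tm Γ (σ ⇒ ι ⇒ σ)) (us : Args Γ σ) →
             H ⊢ 𝐑 · x · y · 𝟎 ⋆ us ≐ x ⋆ us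
  𝐑-zero-⋆ x y = eqAt-⋆ (axiom (R-ax₀ x y))

  𝐑-suc-⋆ : (x : Tm Γ σ) (y : Tm Γ (σ ⇒ ι ⇒ σ)) (n : Tm Γ ι) (us : Args Γ σ) →
            H ⊢ 𝐑 · x · y · (𝐒 · n) ⋆ us ≐ y · (𝐑 · x · y · n) · n ⋆ us
  𝐑-suc-⋆ x y n = eqAt-⋆ (axiom (R-axS x y n))

  𝐁-⋆ : (f : Tm Γ (σ ⇒ τ)) (g : Tm Γ (ρ ⇒ σ)) (x : Tm Γ ρ) (us : Args Γ τ) →
        H ⊢ 𝐁 · f · g · x ⋆ us ≐ f · (g · x) ⋆ us
  𝐁-⋆ {H = H} f g x us = begin
    𝐁 · f · g · x ⋆ us               ≈⟨ 𝚺-⋆ (𝚷 · 𝚺) 𝚷 f (g ∷ᵃ x ∷ᵃ us) ⟩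
    𝚷 · 𝚺 · f · (𝚷 · f) · g · x ⋆ us ≈⟨ 𝚷-⋆ 𝚺 f (𝚷 · f ∷ᵃ g ∷ᵃ x ∷ᵃ us) ⟩
    𝚺 · (𝚷 · f) · g · x ⋆ us         ≈⟨ 𝚺-⋆ (𝚷 · f) g x us ⟩
    𝚷 · f · x · (g · x) ⋆ us         ≈⟨ 𝚷-⋆ f x (g · x ∷ᵃ us) ⟩
    f · (g · x) ⋆ us                 ∎
    where open ≐-Reasoning H

  plus-identityʳ : (x : Tm Γ ι) → H ⊢ plus x 𝟎 ≐ x
  plus-identityʳ x = 𝐑-zero-⋆ x _ []ᵃ

  plus-suc : (x z : Tm Γ ι) → H ⊢ plus x (𝐒 · z) ≐ 𝐒 · plus x z
  plus-suc {H = H} x z = begin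
    plus x (𝐒 · z)                 ≈⟨ 𝐑-suc-⋆ x _ z []ᵃ ⟩
    𝐁 · (𝐁 · 𝐒) · 𝚷 · plus x z · z ≈⟨ 𝐁-⋆ (𝐁 · 𝐒) 𝚷 (plus x z) (z ∷ᵃ []ᵃ) ⟩
    𝐁 · 𝐒 · (𝚷 · plus x z) · z     ≈⟨ 𝐁-⋆ 𝐒 (𝚷 · plus x z) z []ᵃ ⟩
    𝐒 · (𝚷 · plus x z · z)         ≈⟨ ≐-cong-app 𝐒 (𝚷-⋆ (plus x z) z []ᵃ) ⟩
    𝐒 · plus x z                   ∎
    where open ≐-Reasoning H

  plus-identityˡ : H ⊢ ∀ᶠ ι (plus 𝟎 v0 ≐ v0)
  plus-identityˡ = induction _ i≐ (plus-identityʳ 𝟎)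
    (≐-trans (plus-suc 𝟎 v0) (≐-cong-app 𝐒 hyp₀))

  plus-sucˡ : H ⊢ ∀ᶠ ι (∀ᶠ ι (plus (𝐒 · v1) v0 ≐ 𝐒 · plus v1 v0))
  plus-sucˡ = ∀I (induction _ i≐
    (≐-trans (plus-identityʳ _) (≐-sym (≐-cong-app 𝐒 (plus-identityʳ _))))
    (≐-trans (plus-suc _ _) (≐-trans (≐-cong-app 𝐒 hyp₀) (≐-sym (≐-cong-app 𝐒 (plus-suc _ _))))))

  zero-or-suc : H ⊢ ∀ᶠ ι (v0 ≐ 𝟎 ∨ᶠ ∃ᶠ ι (v1 ≐ 𝐒 · v0))
  zero-or-suc = induction _ (i∨ i≐ (i∃ i≐)) (∨I₁ ≐-refl) (∨I₂ (∃I v0 ≐-refl))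

  suc-plus-≢ : H ⊢ ∀ᶠ ι (∀ᶠ ι (plus (𝐒 · v1) v0 ≐ v1 ⊃ ⊥ᶠ))
  suc-plus-≢ = induction _ (i∀ (i⊃ i≐ i⊥))
    (∀I (⊃I (⊃E (axiom (S≠0 _)) (≐-trans (≐-sym (∀E (∀E plus-sucˡ 𝟎) v0)) hyp₀))))
    (∀I (⊃I (⊃E (∀E hyp₁ v0)
      (⊃E (axiom (S-inj _ _)) (≐-trans (≐-sym (∀E (∀E plus-sucˡ (𝐒 · v1)) v0)) hyp₀)))))

  χ<-zero : (m : Tm Γ ι) → H ⊢ χ< 𝟎 · m ≐ 𝟎
  χ<-zero m = ≐-trans (𝐑-zero-⋆ (𝚷 · 𝟎) χ<-step (m ∷ᵃ []ᵃ)) (𝚷-⋆ 𝟎 m []ᵃ)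

  χ<-suc : (N m : Tm Γ ι) → H ⊢ χ< (𝐒 · N) · m ≐ 𝐑 · one · (𝚷 · χ< N) · m
  χ<-suc {H = H} N m = begin
    χ< (𝐒 · N) · m                            ≈⟨ 𝐑-suc-⋆ (𝚷 · 𝟎) χ<-step N (m ∷ᵃ []ᵃ) ⟩
    χ<-step · χ< N · N · m                    ≈⟨ 𝐁-⋆ 𝚷 _ (χ< N) (N ∷ᵃ m ∷ᵃ []ᵃ) ⟩
    𝚷 · (𝐁 · (𝐑 · one) · 𝚷 · χ< N) · N · m    ≈⟨ 𝚷-⋆ _ N (m ∷ᵃ []ᵃ) ⟩
    𝐁 · (𝐑 · one) · 𝚷 · χ< N · m              ≈⟨ 𝐁-⋆ (𝐑 · one) 𝚷 (χ< N) (m ∷ᵃ []ᵃ) ⟩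
    𝐑 · one · (𝚷 · χ< N) · m                  ∎
    where open ≐-Reasoning H

  χ<-suc-zero : (N : Tm Γ ι) → H ⊢ χ< (𝐒 · N) · 𝟎 ≐ one
  χ<-suc-zero N = ≐-trans (χ<-suc N 𝟎) (𝐑-zero-⋆ one _ []ᵃ)

  χ<-suc-suc : (N k : Tm Γ ι) → H ⊢ χ< (𝐒 · N) · (𝐒 · k) ≐ χ< N · k
  χ<-suc-suc N k =
    ≐-trans (χ<-suc N (𝐒 · k)) (≐-trans (𝐑-suc-⋆ one _ k []ᵃ) (𝚷-⋆ (χ< N) _ (k ∷ᵃ []ᵃ)))

  χ<-boolean : H ⊢ ∀ᶠ ι (∀ᶠ ι (χ< v1 · v0 ≐ 𝟎 ∨ᶠ χ< v1 · v0 ≐ one))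
  χ<-boolean = induction _ (i∀ (i∨ i≐ i≐))
    (∀I (∨I₁ (χ<-zero v0)))
    (∀I (∨E (∀E zero-or-suc v0)
      (∨I₂ (≐-trans (≐-cong-app (χ< (𝐒 · v1)) hyp₀) (χ<-suc-zero v1)))
      (∃E hyp₀
        (∨E (∀E hyp₂ v0)
          (∨I₁ (≐-trans (≐-trans (≐-cong-app (χ< (𝐒 · v2)) hyp₁) (χ<-suc-suc v2 v0)) hyp₀))
          (∨I₂ (≐-trans (≐-trans (≐-cong-app (χ< (𝐒 · v2)) hyp₁) (χ<-suc-suc v2 v0)) hyp₀))))))

  -- Induction on N; at N+1 the argument is either 0, where χ<(N+1) is 1,
  -- or k+1, where χ<(N+1)(k+1) = χ<N k.
  χ<≐0⇒≤₀ : H ⊢ ∀ᶠ ι (∀ᶠ ι (χ< v1 · v0 ≐ 𝟎 ⊃ v1 ≤₀ v0))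
  χ<≐0⇒≤₀ = induction _ (i∀ (i⊃ i≐ (i∃ i≐)))
    (∀I (⊃I (∃I v0 (∀E plus-identityˡ v0))))
    (∀I (⊃I (∨E (∀E zero-or-suc v0)
      (⊥E (⊃E (axiom (S≠0 𝟎))
        (≐-trans (≐-sym (χ<-suc-zero v1)) (≐-trans (≐-sym (≐-cong-app (χ< (𝐒 · v1)) hyp₀)) hyp₁))))
      (∃E hyp₀
        (∃E (⊃E (∀E hyp₃ v0)
              (≐-trans (≐-sym (χ<-suc-suc v2 v0))
                       (≐-trans (≐-sym (≐-cong-app (χ< (𝐒 · v2)) hyp₀)) hyp₂)))
          (∃I v0 (≐-trans (∀E (∀E plus-sucˡ v3) v0)
                          (≐-trans (≐-cong-app 𝐒 hyp₀) (≐-sym hyp₁)))))))))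

  χ<-≤*-𝚷-one : H ⊢ ∀ᶠ ι (maj (ι ⇒ ι) (χ< v0) (𝚷 · one))
  χ<-≤*-𝚷-one = ∀I (∀I (∀I (⊃I (∧I
    (∨E (∀E (∀E χ<-boolean v2) v1)
      (∃I one (≐-trans (≐-cong (plus v0 one) hyp₀)
                       (≐-trans (∀E plus-identityˡ one) (≐-sym (𝚷-⋆ one v0 []ᵃ)))))
      (∃I 𝟎 (≐-trans (plus-identityʳ _) (≐-trans hyp₀ (≐-sym (𝚷-⋆ one v0 []ᵃ))))))
    (∃I 𝟎 (≐-trans (plus-identityʳ _) (≐-trans (𝚷-⋆ one v1 []ᵃ) (≐-sym (𝚷-⋆ one v0 []ᵃ)))))))))

  st-𝐒 : {n : Tm Γ ι} → H ⊢ st n → H ⊢ st (𝐒 · n)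
  st-𝐒 = ⊃E (⊃E (axiom (st-app 𝐒 _)) (axiom (st-closed 𝐒)))

  st-χ< : (N : Tm Γ ι) → H ⊢ st (χ< N)
  st-χ< N = ⊃E (⊃E (axiom (st-maj (χ< N) (𝚷 · one))) st-𝚷-one) (∀E χ<-≤*-𝚷-one N)
    where
    st-𝚷-one : H ⊢ st (𝚷 · one)
    st-𝚷-one = axiom (st-closed (𝚷 {ρ = ι} {σ = ι} · one))

  ∃-above-standard : H ⊢ ∃ᶠ ι (∀st ι (v0 ≤₀ v1))
  ∃-above-standard =
    ⊃E (axiom (I-ax (v0 ≤₀ v1) (i∃ i≐))) (∀I (⊃I (⊃I (∃I v0 (∀I (⊃I hyp₀))))))

  ¬all-standard : H ⊢ ∀ᶠ ι (st v0) ⊃ ⊥ᶠ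
  ¬all-standard = ⊃I (∃E ∃-above-standard
    (∃E (⊃E (∀E hyp₀ (𝐒 · v0)) (∀E hyp₁ (𝐒 · v0)))
      (⊃E (∀E (∀E suc-plus-≢ v1) v0) hyp₀)))

  ∃²-spec⇒φ-χ<≐0 : H ⊢ ∃²-spec ⊃ ∀ᶠ ι (v1 · χ< v0 ≐ 𝟎)
  ∃²-spec⇒φ-χ<≐0 = ⊃I (induction _ i≐
    (⊃E (∧E₁ (⊃E (∀E hyp₀ (χ< 𝟎)) (st-χ< 𝟎)))
      (∃I 𝟎 (∧I (axiom (st-closed 𝟎)) (χ<-zero 𝟎))))
    (∃E (⊃E (∧E₂ (⊃E (∀E hyp₁ (χ< v0)) (st-χ< v0))) hyp₀)
      (⊃E (∧E₁ (⊃E (∀E hyp₂ (χ< (𝐒 · v1))) (st-χ< (𝐒 · v1))))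
        (∃I (𝐒 · v0) (∧I (st-𝐒 (∧E₁ hyp₀)) (≐-trans (χ<-suc-suc v1 v0) (∧E₂ hyp₀)))))))

  ∃²-spec⇒all-standard : H ⊢ ∃²-spec ⊃ ∀ᶠ ι (st v0)
  ∃²-spec⇒all-standard = ⊃I (cut (⊃E ∃²-spec⇒φ-χ<≐0 hyp₀)
    (∀I (∃E (⊃E (∧E₂ (⊃E (∀E hyp₁ (χ< v0)) (st-χ< v0))) (∀E hyp₀ v0))
      (⊃E (⊃E (axiom (st-maj v1 v0)) (∧E₁ hyp₀)) (⊃E (∀E (∀E χ<≐0⇒≤₀ v1) v0) (∧E₂ hyp₀))))))

open Derivations dg

theorem3p8 : Inconsistent DG+E2st
theorem3p8 = ∃E (ax e2) (⊃E ¬all-standard (⊃E ∃²-spec⇒all-standard (∧E₂ hyp₀)))
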